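{- For every string $s$ of length $n$, the size of the grammar produced by the LZD parsing of $s$, and the size of the grammar produced by the LZMW parsing of $s$, are each at most $O((n/\log n)^{2/3})\cdot g^*(s)$, where $g^*(s)$ is the size of a smallest context-free grammar generating exactly $s$.
   Context: Strings are over a finite alphabet $\Sigma$, and by convention the input string ends with a special letter $\$$ occurring nowhere else. The LZD parsing of $s$ is $s=p_1\cdots p_z$ where, for each $i$, with $k=|p_1\cdots p_{i-1}|+1$, $p_i=p_{i_1}p_{i_2}$, $p_{i_1}$ is the longest prefix of $s[k..n]$ in $\{p_1,\dots,p_{i-1}\}\cup\Sigma$ and $p_{i_2}$ is the longest prefix of $s[k+|p_{i_1}|..n]$ in $\{p_1,\dots,p_{i-1}\}\cup\Sigma$. The LZMW parsing is $s=p_1\cdots p_z$ where $p_i$ is the longest prefix of $s[k..n]$ in $\{p_jp_{j+1}:1\le j\le i-2\}\cup\Sigma$. The grammar of a parsing has a rule $p_i\to p_jp_k$ ($j,k<i$) or $p_i\to a$ ($a\in\Sigma$) for each phrase and the start rule $S\to p_1\cdots p_z$; the size of a grammar is the total number of symbols on right-hand sides of its rules. -}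

module Defs where

open import Data.Nat using (ℕ; zero; suc; _+_; _<ᵇ_)
open import Data.Bool using (Bool; true; false; if_then_else_; _∧_)
open import Data.Fin using (Fin; _≟_)
open import Data.List using (List; []; _∷_; [_]; _++_; length; drop; foldr; map; concat)
open import Data.Nat.ListAction using (sum)
open import Data.Vec using (Vec; lookup; _∷ʳ_) renaming ([] to []v)
open import Data.Sum using (_⊎_; inj₁; inj₂)
open import Data.Product using (Σ; _×_; _,_; proj₁; proj₂)
open import Data.Maybe using (Maybe; just; nothing)
open import Relation.Nullary.Decidable using (⌊_⌋)
open import Relation.Binary.PropositionalEquality using (_≡_)

Str : ℕ → Set
Str σ = List (Fin σ)

isPrefix : ∀ {σ} → Str σ → Str σ → Bool
isPrefix []       _        = true
isPrefix (_ ∷ _)  []       = false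
isPrefix (a ∷ p)  (b ∷ t)  = ⌊ a ≟ b ⌋ ∧ isPrefix p t

-- Longest prefix of the nonempty string (x ∷ xs) in D ∪ Σ
-- (the single letter x is the only element of Σ that is a prefix).
longestIn : ∀ {σ} → List (Str σ) → Fin σ → Str σ → Str σ
longestIn D x xs =
  foldr (λ p best → if isPrefix p (x ∷ xs) ∧ (length best <ᵇ length p) then p else best)
        [ x ] D

-- Each phrase is returned as the pair (p_{i1} , p_{i2});
-- p_{i2} = [] only if the input is exhausted right after p_{i1}
-- (then the phrase is just p_{i1}).  The natural-number argument is fuel
-- (length s suffices, as every phrase consumes at least one letter).

mutual
  lzd-go : ∀ {σ} → ℕ → List (Str σ) → Str σ → List (Str σ × Str σ)
  lzd-go zero    D _        = []
  lzd-go (suc f) D []       = []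
  lzd-go (suc f) D (x ∷ xs) =
    let p₁ = longestIn D x xs in lzd-second f D p₁ (drop (length p₁) (x ∷ xs))

  lzd-second : ∀ {σ} → ℕ → List (Str σ) → Str σ → Str σ → List (Str σ × Str σ)
  lzd-second f D p₁ []       = (p₁ , []) ∷ []
  lzd-second f D p₁ (y ∷ ys) =
    let p₂ = longestIn D y ys in
    (p₁ , p₂) ∷ lzd-go f (D ++ [ p₁ ++ p₂ ]) (drop (length p₂) (y ∷ ys))

lzd : ∀ {σ} → Str σ → List (Str σ × Str σ)
lzd s = lzd-go (length s) [] s

-- Size of the LZD grammar: start rule S → p₁ ⋯ p_z (z symbols) plus,
-- for each phrase, a rule p_i → p_{i1} p_{i2} (2 symbols), or p_i → p_{i1}
-- (1 symbol) in the degenerate last-phrase case.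
lzdRuleSize : ∀ {σ} → Str σ × Str σ → ℕ
lzdRuleSize (_ , [])    = 1
lzdRuleSize (_ , _ ∷ _) = 2

lzdGrammarSize : ∀ {σ} → Str σ → ℕ
lzdGrammarSize s = length (lzd s) + sum (map lzdRuleSize (lzd s))

-- LZMW parsing.  D holds the concatenations p_j p_{j+1} of consecutive
-- earlier phrases; prev is the previous phrase (if any).

lzmw-go : ∀ {σ} → ℕ → List (Str σ) → Maybe (Str σ) → Str σ → List (Str σ)
lzmw-go zero    D prev _        = []
lzmw-go (suc f) D prev []       = []
lzmw-go (suc f) D prev (x ∷ xs) =
  let p = longestIn D x xs
      D' = addPair prev p
  in p ∷ lzmw-go f D' (just p) (drop (length p) (x ∷ xs))
  where
  addPair : Maybe (Str _) → Str _ → List (Str _)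
  addPair nothing  p = D
  addPair (just q) p = D ++ [ q ++ p ]

lzmw : ∀ {σ} → Str σ → List (Str σ)
lzmw s = lzmw-go (length s) [] nothing s

-- Size of the LZMW grammar: start rule (z symbols), plus a rule
-- p_i → a (1 symbol) for single-letter phrases and p_i → p_j p_{j+1}
-- (2 symbols) otherwise.
lzmwRuleSize : ∀ {σ} → Str σ → ℕ
lzmwRuleSize []          = 0
lzmwRuleSize (_ ∷ [])    = 1
lzmwRuleSize (_ ∷ _ ∷ _) = 2

lzmwGrammarSize : ∀ {σ} → Str σ → ℕ
lzmwGrammarSize s = length (lzmw s) + sum (map lzmwRuleSize (lzmw s))

-- Nonterminals are numbered 0..m-1 in a topological order:
-- the right-hand side of nonterminal i may use terminals and
-- nonterminals j < i.

Sym : ℕ → ℕ → Set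
Sym σ m = Fin σ ⊎ Fin m

data Rules (σ : ℕ) : ℕ → Set where
  []  : Rules σ 0
  _▷_ : ∀ {m} → Rules σ m → List (Sym σ m) → Rules σ (suc m)

expandRHS : ∀ {σ m} → Vec (Str σ) m → List (Sym σ m) → Str σ
expandRHS E []             = []
expandRHS E (inj₁ a ∷ rhs) = a ∷ expandRHS E rhs
expandRHS E (inj₂ j ∷ rhs) = lookup E j ++ expandRHS E rhs

expansions : ∀ {σ m} → Rules σ m → Vec (Str σ) m
expansions []        = []v
expansions (R ▷ rhs) = expansions R ∷ʳ expandRHS (expansions R) rhs

rulesSize : ∀ {σ m} → Rules σ m → ℕ
rulesSize []        = 0
rulesSize (R ▷ rhs) = rulesSize R + length rhs

record Grammar (σ : ℕ) : Set where
  field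
    nNT   : ℕ
    rules : Rules σ nNT
    start : List (Sym σ nNT)

grammarSize : ∀ {σ} → Grammar σ → ℕ
grammarSize G = rulesSize (Grammar.rules G) + length (Grammar.start G)

Generates : ∀ {σ} → Grammar σ → Str σ → Set
Generates G s = expandRHS (expansions (Grammar.rules G)) (Grammar.start G) ≡ s

module Submission where

-- Both parsings cut s, up to one trailing phrase, into blocks of at most two phrases whose
-- concatenations are pairwise distinct: a block p₁ p₂ of longest dictionary prefixes is not
-- in the dictionary (p₁ would have been longer), and each block enters the dictionary once
-- parsed.  A grammar of size g has at most g (2k + 1)² distinct factors of length 1 to k,
-- because each lies within k letters of the end of a right-hand-side symbol of the lowest
-- rule whose expansion contains it; blocks longer than k use up more than k letters each.
-- Hence k m ≤ k g (2k + 1)² + n for the number m of blocks, and k ≈ (n / g)^(1/3) gives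
-- m = O(n^(2/3) g^(1/3)).  The parsing grammars have size f ≤ 3 (2m + 1), so f³ = O(n² g),
-- and log n ≤ g (as n ≤ 2^g) turns this into f³ log² n = O(n² g³).

open import Defs
open import Data.Bool using (true; false; T)
open import Data.Empty using (⊥-elim)
open import Data.Fin using (Fin; zero; suc; _≟_)
open import Data.List using (List; []; _∷_; [_]; _++_; _∷ʳ_; length; drop; take; concat; filter; map)
open import Data.List.Properties
  using (length-++; length-++-≤ˡ; length-++-≤ʳ; ++-assoc; ∷-injective; length-map; length-take; length-drop;
         filter-accept; filter-reject)
open import Data.List.Membership.Propositional using (_∈_; _∉_)
open import Data.List.Membership.Propositional.Properties
  using (∈-++⁺ˡ; ∈-++⁺ʳ; ∈-++⁻; ∈-∃++; ∈-map⁺; ∈-filter⁻)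
open import Data.List.Relation.Binary.Subset.Propositional using (_⊆_)
open import Data.List.Relation.Binary.Subset.Propositional.Properties
  using (⊆-refl; xs⊆xs++ys; xs⊆ys++xs; ++⁺ˡ)
open import Data.List.Relation.Unary.All as All using (All; []; _∷_)
open import Data.List.Relation.Unary.AllPairs using ([]; _∷_)
open import Data.List.Relation.Unary.Any using (here; there)
open import Data.List.Relation.Unary.Unique.Propositional using (Unique)
open import Data.List.Relation.Unary.Unique.Propositional.Properties using (filter⁺)
open import Data.Maybe using (just; nothing)
open import Data.Nat
  using (ℕ; zero; suc; _+_; _*_; _∸_; _^_; _⊓_; _≤_; _<_; _<ᵇ_; _≤?_; z≤n; s≤s; >-nonZero)
open import Data.Nat.ListAction using (sum)
open import Data.Nat.Logarithm using (⌊log₂_⌋; ⌊log₂⌋-mono-≤; ⌊log₂[2^n]⌋≡n)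
open import Data.Nat.Properties hiding (_≟_)
open import Algebra.Properties.CommutativeSemigroup +-commutativeSemigroup
  using () renaming (x∙yz≈y∙xz to +-x∙yz≈y∙xz)
open import Algebra.Properties.CommutativeSemigroup *-commutativeSemigroup
  using () renaming (x∙yz≈y∙xz to *-x∙yz≈y∙xz)
open import Data.Nat.Tactic.RingSolver using (solve-∀)
open import Data.Product using (_×_; _,_; ∃-syntax; proj₁; proj₂)
open import Data.Sum using (_⊎_; inj₁; inj₂)
open import Data.Vec using (Vec; lookup) renaming ([] to []ᵥ; _∷_ to _∷ᵥ_; _∷ʳ_ to _∷ʳᵥ_)
open import Function using (_∘_)
open import Relation.Nullary using (Dec; yes; no)
open import Relation.Binary.PropositionalEquality hiding ([_])

open Grammar using (rules; start)

-- Longest dictionary prefixes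

<ᵇ≡true⇒< : ∀ m n → (m <ᵇ n) ≡ true → m < n
<ᵇ≡true⇒< m n e = <ᵇ⇒< m n (subst T (sym e) _)

<ᵇ≡false⇒≥ : ∀ m n → (m <ᵇ n) ≡ false → n ≤ m
<ᵇ≡false⇒≥ m n e = ≮⇒≥ (λ m<n → subst T e (<⇒<ᵇ m<n))

module _ {σ : ℕ} where

  isPrefix⇒≡++drop : (p t : Str σ) → isPrefix p t ≡ true → t ≡ p ++ drop (length p) t
  isPrefix⇒≡++drop []      t       _ = refl
  isPrefix⇒≡++drop (a ∷ p) (b ∷ t) e with a ≟ b
  ... | yes refl = cong (a ∷_) (isPrefix⇒≡++drop p t e)

  isPrefix-++ : (p r : Str σ) → isPrefix p (p ++ r) ≡ true
  isPrefix-++ []      r = refl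
  isPrefix-++ (a ∷ p) r with a ≟ a
  ... | yes _  = isPrefix-++ p r
  ... | no a≢a = ⊥-elim (a≢a refl)

  longestIn-isPrefix : (D : List (Str σ)) (x : Fin σ) (xs : Str σ) →
    isPrefix (longestIn D x xs) (x ∷ xs) ≡ true
  longestIn-isPrefix []      x xs = isPrefix-++ [ x ] xs
  longestIn-isPrefix (p ∷ D) x xs with isPrefix p (x ∷ xs) in p≼ | length (longestIn D x xs) <ᵇ length p
  ... | true  | true  = p≼
  ... | true  | false = longestIn-isPrefix D x xs
  ... | false | _     = longestIn-isPrefix D x xs

  longestIn-≡++drop : (D : List (Str σ)) (x : Fin σ) (xs : Str σ) →
    x ∷ xs ≡ longestIn D x xs ++ drop (length (longestIn D x xs)) (x ∷ xs)
  longestIn-≡++drop D x xs = isPrefix⇒≡++drop (longestIn D x xs) (x ∷ xs) (longestIn-isPrefix D x xs)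

  longestIn-nonempty : (D : List (Str σ)) (x : Fin σ) (xs : Str σ) → 1 ≤ length (longestIn D x xs)
  longestIn-nonempty []      x xs = s≤s z≤n
  longestIn-nonempty (p ∷ D) x xs with isPrefix p (x ∷ xs) | length (longestIn D x xs) <ᵇ length p in lt
  ... | true  | true  = ≤-trans (longestIn-nonempty D x xs) (<⇒≤ (<ᵇ≡true⇒< _ _ lt))
  ... | true  | false = longestIn-nonempty D x xs
  ... | false | _     = longestIn-nonempty D x xs

  longestIn-longest : (D : List (Str σ)) (x : Fin σ) (xs : Str σ) {d : Str σ} →
    d ∈ D → isPrefix d (x ∷ xs) ≡ true → length d ≤ length (longestIn D x xs)
  longestIn-longest (p ∷ D) x xs d∈ d≼
    with isPrefix p (x ∷ xs) in p≼ | length (longestIn D x xs) <ᵇ length p in lt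
  longestIn-longest (p ∷ D) x xs (here refl) d≼ | true | true  = ≤-refl
  longestIn-longest (p ∷ D) x xs (here refl) d≼ | true | false = <ᵇ≡false⇒≥ _ _ lt
  longestIn-longest (p ∷ D) x xs (there d∈) d≼ | true | true  =
    ≤-trans (longestIn-longest D x xs d∈ d≼) (<⇒≤ (<ᵇ≡true⇒< _ _ lt))
  longestIn-longest (p ∷ D) x xs (there d∈) d≼ | true | false = longestIn-longest D x xs d∈ d≼
  longestIn-longest (p ∷ D) x xs (here refl) d≼ | false | _ with trans (sym d≼) p≼
  ... | ()
  longestIn-longest (p ∷ D) x xs (there d∈) d≼ | false | _ = longestIn-longest D x xs d∈ d≼

  longestIn-extension-∉ : (D : List (Str σ)) (x : Fin σ) (xs p r : Str σ) → 1 ≤ length p →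
    x ∷ xs ≡ (longestIn D x xs ++ p) ++ r → longestIn D x xs ++ p ∉ D
  longestIn-extension-∉ D x xs p r p≢[] eq q∈D = ≤⇒≯ (longestIn-longest D x xs q∈D q≼) longer
    where
    q = longestIn D x xs ++ p
    q≼ : isPrefix q (x ∷ xs) ≡ true
    q≼ = subst (λ t → isPrefix q t ≡ true) (sym eq) (isPrefix-++ q r)
    longer : length (longestIn D x xs) < length (longestIn D x xs ++ p)
    longer = ≤-trans (m<m+n _ p≢[]) (≤-reflexive (sym (length-++ (longestIn D x xs))))

-- Parsings into distinct blocks

-- The blocks are consecutive factors at the start of t, each concatenating at most a of the
-- phrases ps; only the resulting count phrases≤ is recorded.  Freshness for the dictionary D
-- is what makes the invariant inductive.
record DistinctBlocks {σ} {A : Set} (a : ℕ) (D : List (Str σ)) (ps : List A) (t : Str σ) : Set where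
  field
    blocks          : List (Str σ)
    blocks-unique   : Unique blocks
    blocks-∉        : All (_∉ D) blocks
    blocks-nonempty : All (λ q → 1 ≤ length q) blocks
    phrases≤        : length ps ≤ 1 + a * length blocks
    blocks-prefix   : ∃[ r ] concat blocks ++ r ≡ t

module _ {σ : ℕ} {A : Set} (a : ℕ) where

  open DistinctBlocks

  distinctBlocks-≤1 : {D : List (Str σ)} {ps : List A} {t : Str σ} →
    length ps ≤ 1 → DistinctBlocks a D ps t
  distinctBlocks-≤1 {t = t} ps≤1 = record
    { blocks = [] ; blocks-unique = [] ; blocks-∉ = [] ; blocks-nonempty = []
    ; phrases≤ = ≤-trans ps≤1 (m≤m+n 1 _) ; blocks-prefix = t , refl }

  distinctBlocks-⊆ : {D D′ : List (Str σ)} {ps : List A} {t : Str σ} →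
    D ⊆ D′ → DistinctBlocks a D′ ps t → DistinctBlocks a D ps t
  distinctBlocks-⊆ D⊆D′ B = record
    { blocks = blocks B ; blocks-unique = blocks-unique B
    ; blocks-∉ = All.map (λ q∉D′ q∈D → q∉D′ (D⊆D′ q∈D)) (blocks-∉ B)
    ; blocks-nonempty = blocks-nonempty B ; phrases≤ = phrases≤ B ; blocks-prefix = blocks-prefix B }

  distinctBlocks-∷ : {D : List (Str σ)} {q : Str σ} (extra : List A) {ps : List A} {t : Str σ} →
    q ∉ D → 1 ≤ length q → length extra ≤ a →
    DistinctBlocks a (D ++ [ q ]) ps t → DistinctBlocks a D (extra ++ ps) (q ++ t)
  distinctBlocks-∷ {D} {q} extra {ps} q∉D q≢[] extra≤a B = record
    { blocks          = q ∷ blocks B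
    ; blocks-unique   = All.map (λ q′∉ q≡q′ → q′∉ (∈-++⁺ʳ D (here (sym q≡q′)))) (blocks-∉ B) ∷ blocks-unique B
    ; blocks-∉        = q∉D ∷ All.map (λ q′∉ q′∈D → q′∉ (∈-++⁺ˡ q′∈D)) (blocks-∉ B)
    ; blocks-nonempty = q≢[] ∷ blocks-nonempty B
    ; phrases≤        = begin
        length (extra ++ ps)                   ≡⟨ length-++ extra ⟩
        length extra + length ps               ≤⟨ +-mono-≤ extra≤a (phrases≤ B) ⟩
        a + (1 + a * length (blocks B))        ≡⟨ +-suc a _ ⟩
        1 + (a + a * length (blocks B))        ≡⟨ cong suc (*-suc a _) ⟨
        1 + a * length (q ∷ blocks B)          ∎
    ; blocks-prefix   = proj₁ (blocks-prefix B) ,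
                        trans (++-assoc q _ _) (cong (q ++_) (proj₂ (blocks-prefix B)))
    }
    where open ≤-Reasoning

  distinctBlocks-longestPair : (D D′ : List (Str σ)) (x : Fin σ) (xs : Str σ) (y : Fin σ) (ys : Str σ)
    (extra ps : List A) → x ∷ xs ≡ longestIn D x xs ++ y ∷ ys → length extra ≤ a →
    let p₂ = longestIn D′ y ys in
    DistinctBlocks a (D ++ [ longestIn D x xs ++ p₂ ]) ps (drop (length p₂) (y ∷ ys)) →
    DistinctBlocks a D (extra ++ ps) (x ∷ xs)
  distinctBlocks-longestPair D D′ x xs y ys extra ps eq extra≤a B =
    subst (DistinctBlocks a D (extra ++ ps)) (sym split)
      (distinctBlocks-∷ extra (longestIn-extension-∉ D x xs p₂ t (longestIn-nonempty D′ y ys) split)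
        q≢[] extra≤a B)
    where
    p₁ = longestIn D x xs
    p₂ = longestIn D′ y ys
    t  = drop (length p₂) (y ∷ ys)
    split : x ∷ xs ≡ (p₁ ++ p₂) ++ t
    split = begin
      x ∷ xs            ≡⟨ eq ⟩
      p₁ ++ y ∷ ys      ≡⟨ cong (p₁ ++_) (longestIn-≡++drop D′ y ys) ⟩
      p₁ ++ p₂ ++ t     ≡⟨ ++-assoc p₁ p₂ t ⟨
      (p₁ ++ p₂) ++ t   ∎
      where open ≡-Reasoning
    q≢[] : 1 ≤ length (p₁ ++ p₂)
    q≢[] = ≤-trans (longestIn-nonempty D x xs) (≤-trans (m≤m+n _ _) (≤-reflexive (sym (length-++ p₁))))

mutual
  lzd-go-blocks : ∀ {σ} f (D : List (Str σ)) t → DistinctBlocks 1 D (lzd-go f D t) t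
  lzd-go-blocks zero    D t        = distinctBlocks-≤1 1 z≤n
  lzd-go-blocks (suc f) D []       = distinctBlocks-≤1 1 z≤n
  lzd-go-blocks (suc f) D (x ∷ xs) = lzd-second-blocks f D x xs _ (longestIn-≡++drop D x xs)

  lzd-second-blocks : ∀ {σ} f (D : List (Str σ)) x xs t → x ∷ xs ≡ longestIn D x xs ++ t →
    DistinctBlocks 1 D (lzd-second f D (longestIn D x xs) t) (x ∷ xs)
  lzd-second-blocks f D x xs []       _  = distinctBlocks-≤1 1 ≤-refl
  lzd-second-blocks f D x xs (y ∷ ys) eq =
    distinctBlocks-longestPair 1 D D x xs y ys [ _ ] _ eq ≤-refl (lzd-go-blocks f _ _)

mutual
  lzmw-go-blocks : ∀ {σ} f (D : List (Str σ)) prev t → DistinctBlocks 2 D (lzmw-go f D prev t) t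
  lzmw-go-blocks zero    D prev     t        = distinctBlocks-≤1 2 z≤n
  lzmw-go-blocks (suc f) D prev     []       = distinctBlocks-≤1 2 z≤n
  lzmw-go-blocks (suc f) D nothing  (x ∷ xs) =
    lzmw-next-blocks f D D x xs _ ⊆-refl (longestIn-≡++drop D x xs)
  lzmw-go-blocks (suc f) D (just _) (x ∷ xs) =
    lzmw-next-blocks f D _ x xs _ (xs⊆xs++ys D _) (longestIn-≡++drop D x xs)

  -- D′ ⊇ D is the dictionary when the second phrase of the block is parsed.
  lzmw-next-blocks : ∀ {σ} f (D D′ : List (Str σ)) x xs t → D ⊆ D′ → x ∷ xs ≡ longestIn D x xs ++ t →
    DistinctBlocks 2 D (longestIn D x xs ∷ lzmw-go f D′ (just (longestIn D x xs)) t) (x ∷ xs)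
  lzmw-next-blocks zero    D D′ x xs t        _     _  = distinctBlocks-≤1 2 ≤-refl
  lzmw-next-blocks (suc f) D D′ x xs []       _     _  = distinctBlocks-≤1 2 ≤-refl
  lzmw-next-blocks (suc f) D D′ x xs (y ∷ ys) D⊆D′ eq =
    distinctBlocks-longestPair 2 D D′ x xs y ys (_ ∷ _ ∷ []) _ eq ≤-refl
      (distinctBlocks-⊆ 2 (++⁺ˡ _ D⊆D′) (lzmw-go-blocks f _ _ _))

lzd-distinctBlocks : ∀ {σ} (s : Str σ) → DistinctBlocks 1 [] (lzd s) s
lzd-distinctBlocks s = lzd-go-blocks (length s) [] s

lzmw-distinctBlocks : ∀ {σ} (s : Str σ) → DistinctBlocks 2 [] (lzmw s) s
lzmw-distinctBlocks s = lzmw-go-blocks (length s) [] nothing s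

-- Factors and windows

module _ {A : Set} where

  Factor : List A → List A → Set
  Factor u w = ∃[ a ] ∃[ b ] a ++ u ++ b ≡ w

  prefixes : List A → List (List A)
  prefixes []       = [ [] ]
  prefixes (x ∷ xs) = [] ∷ map (x ∷_) (prefixes xs)

  factors : List A → List (List A)
  factors []       = [ [] ]
  factors (x ∷ xs) = prefixes (x ∷ xs) ++ factors xs

  length-prefixes : (xs : List A) → length (prefixes xs) ≡ suc (length xs)
  length-prefixes []       = refl
  length-prefixes (x ∷ xs) = cong suc (trans (length-map (x ∷_) (prefixes xs)) (length-prefixes xs))

  length-factors : (xs : List A) → length (factors xs) ≤ suc (length xs) * suc (length xs)
  length-factors []       = ≤-refl
  length-factors (x ∷ xs) = begin
    length (prefixes (x ∷ xs) ++ factors xs)          ≡⟨ length-++ (prefixes (x ∷ xs)) ⟩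
    length (prefixes (x ∷ xs)) + length (factors xs)  ≡⟨ cong (_+ length (factors xs)) (length-prefixes (x ∷ xs)) ⟩
    suc n + length (factors xs)                       ≤⟨ +-monoʳ-≤ (suc n) (length-factors xs) ⟩
    suc n + n * n                                     ≤⟨ +-monoʳ-≤ (suc n) (*-monoʳ-≤ n (n≤1+n n)) ⟩
    suc n * suc n                                     ∎
    where
    open ≤-Reasoning
    n = suc (length xs)

  ∈-prefixes : (u b : List A) → u ∈ prefixes (u ++ b)
  ∈-prefixes []      []      = here refl
  ∈-prefixes []      (_ ∷ _) = here refl
  ∈-prefixes (x ∷ u) b       = there (∈-map⁺ (x ∷_) (∈-prefixes u b))

  factor⇒∈factors : {u w : List A} → Factor u w → u ∈ factors w
  factor⇒∈factors {u} (a , b , refl) = ∈-factors a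
    where
    ∈-factors : (a : List A) → u ∈ factors (a ++ u ++ b)
    ∈-factors []      with u ++ b | ∈-prefixes u b
    ... | []    | u∈ = u∈
    ... | _ ∷ _ | u∈ = ∈-++⁺ˡ u∈
    ∈-factors (x ∷ a) = ∈-++⁺ʳ (prefixes (x ∷ a ++ u ++ b)) (∈-factors a)

  ++-≡-++ : (a r e y : List A) → a ++ r ≡ e ++ y →
    (∃[ m ] e ≡ a ++ m × r ≡ m ++ y) ⊎ (∃[ m ] a ≡ e ++ m × y ≡ m ++ r)
  ++-≡-++ []      r e       y eq = inj₁ (e , refl , eq)
  ++-≡-++ (x ∷ a) r []      y eq = inj₂ (x ∷ a , refl , sym eq)
  ++-≡-++ (x ∷ a) r (z ∷ e) y eq with ∷-injective eq
  ... | refl , eq′ with ++-≡-++ a r e y eq′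
  ...   | inj₁ (m , e≡ , r≡) = inj₁ (m , cong (x ∷_) e≡ , r≡)
  ...   | inj₂ (m , a≡ , y≡) = inj₂ (m , cong (x ∷_) a≡ , y≡)

  drop-++ : ∀ n (a m : List A) → n ≤ length a → drop n (a ++ m) ≡ drop n a ++ m
  drop-++ zero    a       m _         = refl
  drop-++ (suc n) (x ∷ a) m (s≤s n≤a) = drop-++ n a m n≤a

  take-++ : ∀ k (m b : List A) → length m ≤ k → take k (m ++ b) ≡ m ++ take (k ∸ length m) b
  take-++ k       []      b _         = refl
  take-++ (suc k) (x ∷ m) b (s≤s m≤k) = cong (x ∷_) (take-++ k m b m≤k)

  window : ℕ → List A → List A → List A
  window k e y = drop (length e ∸ k) e ++ take k y

  length-window : ∀ k (e y : List A) → length (window k e y) ≤ k + k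
  length-window k e y = begin
    length (window k e y)                         ≡⟨ length-++ (drop (length e ∸ k) e) ⟩
    length (drop (length e ∸ k) e) + length (take k y)
      ≡⟨ cong₂ _+_ (length-drop (length e ∸ k) e) (length-take k y) ⟩
    (length e ∸ (length e ∸ k)) + (k ⊓ length y)  ≤⟨ +-mono-≤ (m∸[m∸n]≤n (length e) k) (m⊓n≤m k _) ⟩
    k + k                                         ∎
    where
    open ≤-Reasoning
    m∸[m∸n]≤n : ∀ m n → m ∸ (m ∸ n) ≤ n
    m∸[m∸n]≤n m n with ≤-total n m
    ... | inj₁ n≤m = ≤-reflexive (m∸[m∸n]≡n n≤m)
    ... | inj₂ m≤n = ≤-trans (m∸n≤m m (m ∸ n)) m≤n

  factor-window-short : ∀ k {u e : List A} (y : List A) → length e ≤ k →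
    Factor u e → Factor u (window k e y)
  factor-window-short k {u} y e≤k (a , b , refl) rewrite m≤n⇒m∸n≡0 e≤k =
    a , b ++ take k y , trans (cong (a ++_) (sym (++-assoc u b _))) (sym (++-assoc a (u ++ b) _))

  factor-window-crossing : ∀ k (a m n b : List A) → length (m ++ n) ≤ k →
    Factor (m ++ n) (window k (a ++ m) (n ++ b))
  factor-window-crossing k a m n b mn≤k = drop d a , take (k ∸ length n) b , (begin
    drop d a ++ (m ++ n) ++ take (k ∸ length n) b   ≡⟨ cong (drop d a ++_) (++-assoc m n _) ⟩
    drop d a ++ m ++ n ++ take (k ∸ length n) b     ≡⟨ ++-assoc (drop d a) m _ ⟨
    (drop d a ++ m) ++ n ++ take (k ∸ length n) b   ≡⟨ cong₂ _++_ (drop-++ d a m d≤a) (take-++ k n b n≤k) ⟨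
    window k (a ++ m) (n ++ b)                      ∎)
    where
    open ≡-Reasoning
    d = length (a ++ m) ∸ k
    m≤k : length m ≤ k
    m≤k = ≤-trans (length-++-≤ˡ m) mn≤k
    n≤k : length n ≤ k
    n≤k = ≤-trans (length-++-≤ʳ n {m}) mn≤k
    d≤a : d ≤ length a
    d≤a = ≤-trans (≤-reflexive (cong (_∸ k) (length-++ a)))
            (≤-trans (∸-monoʳ-≤ (length a + length m) m≤k) (≤-reflexive (m+n∸n≡m (length a) (length m))))

  factor-++ : ∀ k {u : List A} (e y : List A) → length u ≤ k → Factor u (e ++ y) →
    Factor u e ⊎ Factor u y ⊎ Factor u (window k e y)
  factor-++ k {u} e y u≤k (a , b , eq) with ++-≡-++ a (u ++ b) e y eq
  ... | inj₂ (m , _ , refl) = inj₂ (inj₁ (m , b , refl))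
  ... | inj₁ (m , refl , ub≡) with ++-≡-++ u b m y ub≡
  ...   | inj₁ (m′ , refl , _) = inj₁ (a , m′ , refl)
  ...   | inj₂ (n , refl , refl) = inj₂ (inj₂ (factor-window-crossing k a m n b u≤k))

  ShortFactorsIn : ℕ → List A → List (List A) → Set
  ShortFactorsIn k w L = ∀ {u} → 1 ≤ length u → length u ≤ k → Factor u w → u ∈ L

  shortFactorsIn-⊆ : ∀ {k w L L′} → L ⊆ L′ → ShortFactorsIn k w L → ShortFactorsIn k w L′
  shortFactorsIn-⊆ L⊆L′ cover u≢[] u≤k f = L⊆L′ (cover u≢[] u≤k f)

-- Short factors and length of a grammar-generated string

lookup-∷ʳ⁺ : ∀ {A : Set} {P : A → Set} {n} (E : Vec A n) {x : A} →
  (∀ j → P (lookup E j)) → P x → ∀ j → P (lookup (E ∷ʳᵥ x) j)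
lookup-∷ʳ⁺ []ᵥ      _  Px zero    = Px
lookup-∷ʳ⁺ (_ ∷ᵥ E) PE _  zero    = PE zero
lookup-∷ʳ⁺ {P = P} (_ ∷ᵥ E) PE Px (suc j) = lookup-∷ʳ⁺ {P = P} E (PE ∘ suc) Px j

module _ {σ n : ℕ} where

  symExpansion : Vec (Str σ) n → Sym σ n → Str σ
  symExpansion E (inj₁ c) = [ c ]
  symExpansion E (inj₂ j) = lookup E j

  expandRHS-∷ : (E : Vec (Str σ) n) (X : Sym σ n) (rhs : List (Sym σ n)) →
    expandRHS E (X ∷ rhs) ≡ symExpansion E X ++ expandRHS E rhs
  expandRHS-∷ E (inj₁ c) rhs = refl
  expandRHS-∷ E (inj₂ j) rhs = refl

  boundaryFactors : ℕ → Vec (Str σ) n → List (Sym σ n) → List (Str σ)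
  boundaryFactors k E []        = []
  boundaryFactors k E (X ∷ rhs) =
    factors (window k (symExpansion E X) (expandRHS E rhs)) ++ boundaryFactors k E rhs

  boundaryFactors-complete : ∀ k (E : Vec (Str σ) n) {L} → (∀ j → ShortFactorsIn k (lookup E j) L) →
    ∀ rhs → ShortFactorsIn k (expandRHS E rhs) (boundaryFactors k E rhs ++ L)
  boundaryFactors-complete k E cover [] {_ ∷ _} _ _ ([]    , _ , ())
  boundaryFactors-complete k E cover [] {_ ∷ _} _ _ (_ ∷ _ , _ , ())
  boundaryFactors-complete k E {L} cover (X ∷ rhs) u≢[] u≤k f
    with factor-++ k (symExpansion E X) (expandRHS E rhs) u≤k (subst (Factor _) (expandRHS-∷ E X rhs) f)
  ... | inj₂ (inj₂ fw) = ∈-++⁺ˡ (∈-++⁺ˡ (factor⇒∈factors fw))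
  ... | inj₂ (inj₁ fr) = subst (_ ∈_) (sym (++-assoc (factors W) _ L))
                           (∈-++⁺ʳ (factors W) (boundaryFactors-complete k E cover rhs u≢[] u≤k fr))
    where W = window k (symExpansion E X) (expandRHS E rhs)
  ... | inj₁ fX with X
  ...   | inj₁ c = ∈-++⁺ˡ (∈-++⁺ˡ (factor⇒∈factors (factor-window-short k _ (≤-trans u≢[] u≤k) fX)))
  ...   | inj₂ j = ∈-++⁺ʳ (boundaryFactors k E (inj₂ j ∷ rhs)) (cover j u≢[] u≤k fX)

  length-boundaryFactors : ∀ k (E : Vec (Str σ) n) rhs →
    length (boundaryFactors k E rhs) ≤ length rhs * (suc (k + k) * suc (k + k))
  length-boundaryFactors k E []        = z≤n
  length-boundaryFactors k E (X ∷ rhs) = begin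
    length (factors W ++ boundaryFactors k E rhs)          ≡⟨ length-++ (factors W) ⟩
    length (factors W) + length (boundaryFactors k E rhs)
      ≤⟨ +-mono-≤ (length-factors W) (length-boundaryFactors k E rhs) ⟩
    suc (length W) * suc (length W) + length rhs * B       ≤⟨ +-monoˡ-≤ _ (*-mono-≤ W≤ W≤) ⟩
    B + length rhs * B                                     ∎
    where
    open ≤-Reasoning
    W = window k (symExpansion E X) (expandRHS E rhs)
    B = suc (k + k) * suc (k + k)
    W≤ : suc (length W) ≤ suc (k + k)
    W≤ = s≤s (length-window k (symExpansion E X) (expandRHS E rhs))

module _ {σ : ℕ} where

  ruleFactors : ∀ {n} → ℕ → Rules σ n → List (Str σ)
  ruleFactors k []        = []
  ruleFactors k (R ▷ rhs) = boundaryFactors k (expansions R) rhs ++ ruleFactors k R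

  ruleFactors-complete : ∀ {n} k (R : Rules σ n) j →
    ShortFactorsIn k (lookup (expansions R) j) (ruleFactors k R)
  ruleFactors-complete k (R ▷ rhs) =
    lookup-∷ʳ⁺ {P = λ w → ShortFactorsIn k w (ruleFactors k (R ▷ rhs))} (expansions R)
      (λ j → shortFactorsIn-⊆ (xs⊆ys++xs _ _) (ruleFactors-complete k R j))
      (boundaryFactors-complete k (expansions R) (ruleFactors-complete k R) rhs)

  length-ruleFactors : ∀ {n} k (R : Rules σ n) →
    length (ruleFactors k R) ≤ rulesSize R * (suc (k + k) * suc (k + k))
  length-ruleFactors k []        = z≤n
  length-ruleFactors k (R ▷ rhs) = begin
    length (bf ++ ruleFactors k R)            ≡⟨ length-++ bf ⟩
    length bf + length (ruleFactors k R)      ≤⟨ +-mono-≤ (length-boundaryFactors k _ rhs) (length-ruleFactors k R) ⟩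
    length rhs * B + rulesSize R * B          ≡⟨ +-comm (length rhs * B) _ ⟩
    rulesSize R * B + length rhs * B          ≡⟨ *-distribʳ-+ B (rulesSize R) (length rhs) ⟨
    (rulesSize R + length rhs) * B            ∎
    where
    open ≤-Reasoning
    bf = boundaryFactors k (expansions R) rhs
    B  = suc (k + k) * suc (k + k)

  grammarFactors : ℕ → Grammar σ → List (Str σ)
  grammarFactors k G = ruleFactors k (rules G ▷ start G)

  grammarFactors-complete : ∀ k (G : Grammar σ) {s} → Generates G s → ShortFactorsIn k s (grammarFactors k G)
  grammarFactors-complete k G refl =
    boundaryFactors-complete k (expansions (rules G)) (ruleFactors-complete k (rules G)) (start G)

  length-grammarFactors : ∀ k (G : Grammar σ) →
    length (grammarFactors k G) ≤ grammarSize G * (suc (k + k) * suc (k + k))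
  length-grammarFactors k G = length-ruleFactors k (rules G ▷ start G)

n≤2^n : ∀ n → n ≤ 2 ^ n
n≤2^n zero    = z≤n
n≤2^n (suc n) =
  ≤-trans (+-mono-≤ (m^n>0 2 n) (n≤2^n n)) (≤-reflexive (cong (2 ^ n +_) (sym (+-identityʳ (2 ^ n)))))

module _ {σ : ℕ} where

  length-expandRHS : ∀ {n} (E : Vec (Str σ) n) {M} → 1 ≤ M → (∀ j → length (lookup E j) ≤ M) →
    ∀ rhs → length (expandRHS E rhs) ≤ length rhs * M
  length-expandRHS E 1≤M E≤M []             = z≤n
  length-expandRHS E 1≤M E≤M (inj₁ c ∷ rhs) = +-mono-≤ 1≤M (length-expandRHS E 1≤M E≤M rhs)
  length-expandRHS E 1≤M E≤M (inj₂ j ∷ rhs) =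
    ≤-trans (≤-reflexive (length-++ (lookup E j))) (+-mono-≤ (E≤M j) (length-expandRHS E 1≤M E≤M rhs))

  length-expandRHS-≤2^ : ∀ {n} (E : Vec (Str σ) n) S → (∀ j → length (lookup E j) ≤ 2 ^ S) →
    ∀ rhs → length (expandRHS E rhs) ≤ 2 ^ (S + length rhs)
  length-expandRHS-≤2^ E S E≤ rhs = begin
    length (expandRHS E rhs)   ≤⟨ length-expandRHS E (m^n>0 2 S) E≤ rhs ⟩
    length rhs * 2 ^ S         ≤⟨ *-monoˡ-≤ (2 ^ S) (n≤2^n (length rhs)) ⟩
    2 ^ length rhs * 2 ^ S     ≡⟨ *-comm (2 ^ length rhs) _ ⟩
    2 ^ S * 2 ^ length rhs     ≡⟨ ^-distribˡ-+-* 2 S (length rhs) ⟨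
    2 ^ (S + length rhs)       ∎
    where open ≤-Reasoning

  length-expansions : ∀ {n} (R : Rules σ n) j → length (lookup (expansions R) j) ≤ 2 ^ rulesSize R
  length-expansions (R ▷ rhs) =
    lookup-∷ʳ⁺ {P = λ w → length w ≤ 2 ^ rulesSize (R ▷ rhs)} (expansions R)
      (λ j → ≤-trans (length-expansions R j) (^-monoʳ-≤ 2 (m≤m+n (rulesSize R) (length rhs))))
      (length-expandRHS-≤2^ (expansions R) (rulesSize R) (length-expansions R) rhs)

  length≤2^grammarSize : (G : Grammar σ) {s : Str σ} → Generates G s → length s ≤ 2 ^ grammarSize G
  length≤2^grammarSize G refl =
    length-expandRHS-≤2^ (expansions (rules G)) (rulesSize (rules G)) (length-expansions (rules G)) (start G)

-- Counting blocks

module _ {A : Set} where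

  unique-⊆⇒length≤ : {xs ys : List A} → Unique xs → xs ⊆ ys → length xs ≤ length ys
  unique-⊆⇒length≤ {[]}     _            _      = z≤n
  unique-⊆⇒length≤ {x ∷ xs} (x∉xs ∷ uxs) xs⊆ys with ∈-∃++ (xs⊆ys (here refl))
  ... | ys₁ , ys₂ , refl = begin
    suc (length xs)                 ≤⟨ s≤s (unique-⊆⇒length≤ uxs xs⊆ys₁ys₂) ⟩
    suc (length (ys₁ ++ ys₂))       ≡⟨ cong suc (length-++ ys₁) ⟩
    suc (length ys₁ + length ys₂)   ≡⟨ +-suc (length ys₁) _ ⟨
    length ys₁ + length (x ∷ ys₂)   ≡⟨ length-++ ys₁ ⟨
    length (ys₁ ++ x ∷ ys₂)         ∎
    where
    open ≤-Reasoning
    xs⊆ys₁ys₂ : xs ⊆ ys₁ ++ ys₂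
    xs⊆ys₁ys₂ {y} y∈xs with ∈-++⁻ ys₁ (xs⊆ys (there y∈xs))
    ... | inj₁ y∈ys₁         = ∈-++⁺ˡ y∈ys₁
    ... | inj₂ (here refl)   = ⊥-elim (All.lookup x∉xs y∈xs refl)
    ... | inj₂ (there y∈ys₂) = ∈-++⁺ʳ ys₁ y∈ys₂

  short? : (k : ℕ) (u : List A) → Dec (length u ≤ k)
  short? k u = length u ≤? k

  *-length≤short+length-concat : ∀ k (Q : List (List A)) →
    k * length Q ≤ k * length (filter (short? k) Q) + length (concat Q)
  *-length≤short+length-concat k []      = m≤m+n (k * 0) 0
  *-length≤short+length-concat k (q ∷ Q) with short? k q
  ... | yes q≤k rewrite filter-accept (short? k) {x = q} {xs = Q} q≤k = begin
    k * suc (length Q)                                  ≡⟨ *-suc k (length Q) ⟩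
    k + k * length Q                                    ≤⟨ +-monoʳ-≤ k (*-length≤short+length-concat k Q) ⟩
    k + (k * length S + length (concat Q))              ≡⟨ +-assoc k _ _ ⟨
    k + k * length S + length (concat Q)                ≡⟨ cong (_+ length (concat Q)) (*-suc k (length S)) ⟨
    k * suc (length S) + length (concat Q)              ≤⟨ +-monoʳ-≤ (k * suc (length S)) (m≤n+m _ (length q)) ⟩
    k * suc (length S) + (length q + length (concat Q)) ≡⟨ cong (k * suc (length S) +_) (length-++ q) ⟨
    k * suc (length S) + length (concat (q ∷ Q))        ∎
    where
    open ≤-Reasoning
    S = filter (short? k) Q
  ... | no q≰k rewrite filter-reject (short? k) {x = q} {xs = Q} q≰k = begin
    k * suc (length Q)                                  ≡⟨ *-suc k (length Q) ⟩
    k + k * length Q                                    ≤⟨ +-mono-≤ (<⇒≤ (≰⇒> q≰k)) (*-length≤short+length-concat k Q) ⟩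
    length q + (k * length S + length (concat Q))       ≡⟨ +-x∙yz≈y∙xz (length q) (k * length S) _ ⟩
    k * length S + (length q + length (concat Q))       ≡⟨ cong (k * length S +_) (length-++ q) ⟨
    k * length S + length (concat (q ∷ Q))              ∎
    where
    open ≤-Reasoning
    S = filter (short? k) Q

  length≤length-concat : {Q : List (List A)} → All (λ q → 1 ≤ length q) Q → length Q ≤ length (concat Q)
  length≤length-concat []                 = z≤n
  length≤length-concat {q ∷ Q} (q≢[] ∷ ne) =
    ≤-trans (+-mono-≤ q≢[] (length≤length-concat ne)) (≤-reflexive (sym (length-++ q)))

  ∈⇒factor-concat++ : {q : List A} (Q : List (List A)) (r : List A) → q ∈ Q → Factor q (concat Q ++ r)
  ∈⇒factor-concat++ (q ∷ Q) r (here refl) = [] , concat Q ++ r , sym (++-assoc q (concat Q) r)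
  ∈⇒factor-concat++ (p ∷ Q) r (there q∈Q) with ∈⇒factor-concat++ Q r q∈Q
  ... | a , b , eq =
    p ++ a , b , trans (++-assoc p a _) (trans (cong (p ++_) eq) (sym (++-assoc p (concat Q) r)))

module _ {σ : ℕ} {A : Set} {a : ℕ} {D : List (Str σ)} {ps : List A} {s : Str σ}
         (B : DistinctBlocks a D ps s) where

  open DistinctBlocks B

  length-concat-blocks≤ : length (concat blocks) ≤ length s
  length-concat-blocks≤ =
    subst (λ t → length (concat blocks) ≤ length t) (proj₂ blocks-prefix) (length-++-≤ˡ (concat blocks))

  length-blocks≤ : length blocks ≤ length s
  length-blocks≤ = ≤-trans (length≤length-concat blocks-nonempty) length-concat-blocks≤

  *-length-blocks≤ : (G : Grammar σ) → Generates G s → ∀ k →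
    k * length blocks ≤ k * (grammarSize G * (suc (k + k) * suc (k + k))) + length s
  *-length-blocks≤ G gen k = begin
    k * length blocks                               ≤⟨ *-length≤short+length-concat k blocks ⟩
    k * length short + length (concat blocks)       ≤⟨ +-mono-≤ (*-monoʳ-≤ k short≤) length-concat-blocks≤ ⟩
    k * (grammarSize G * (suc (k + k) * suc (k + k))) + length s ∎
    where
    open ≤-Reasoning
    short = filter (short? k) blocks
    short⊆ : short ⊆ grammarFactors k G
    short⊆ q∈short with ∈-filter⁻ (short? k) q∈short
    ... | q∈blocks , q≤k = grammarFactors-complete k G gen (All.lookup blocks-nonempty q∈blocks) q≤k
      (subst (Factor _) (proj₂ blocks-prefix) (∈⇒factor-concat++ blocks (proj₁ blocks-prefix) q∈blocks))
    short≤ : length short ≤ grammarSize G * (suc (k + k) * suc (k + k))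
    short≤ =
      ≤-trans (unique-⊆⇒length≤ (filter⁺ (short? k) blocks-unique) short⊆) (length-grammarFactors k G)

-- Arithmetic

cube-bracket : ∀ g n m → 0 < n → n ≤ g * suc m ^ 3 → ∃[ j ] g * j ^ 3 < n × n ≤ g * suc j ^ 3
cube-bracket g n zero    0<n n≤ = 0 , subst (_< n) (sym (*-zeroʳ g)) 0<n , n≤
cube-bracket g n (suc m) 0<n n≤ with n ≤? g * suc m ^ 3
... | yes n≤′ = cube-bracket g n m 0<n n≤′
... | no  n≰  = suc m , ≰⇒> n≰ , n≤

n≤g*[1+n]^3 : ∀ g n → 1 ≤ g → n ≤ g * suc n ^ 3
n≤g*[1+n]^3 (suc g) n _ = ≤-trans (n≤1+n n) (≤-trans (m≤m*n (suc n) (suc n ^ 2)) (m≤m+n (suc n ^ 3) _))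

cube-bound : ∀ c F n g k → 0 < n → n ≤ g * k ^ 3 → F * k ≤ c * n → F ^ 3 ≤ c ^ 3 * n ^ 2 * g
cube-bound c F n g k 0<n n≤ Fk≤ = *-cancelˡ-≤ n {{>-nonZero 0<n}} (begin
  n * F ^ 3                ≤⟨ *-monoˡ-≤ (F ^ 3) n≤ ⟩
  g * k ^ 3 * F ^ 3        ≡⟨ reassoc₁ g k F ⟩
  g * (F * k) ^ 3          ≤⟨ *-monoʳ-≤ g (^-monoˡ-≤ 3 Fk≤) ⟩
  g * (c * n) ^ 3          ≡⟨ reassoc₂ g c n ⟩
  n * (c ^ 3 * n ^ 2 * g)  ∎)
  where
  open ≤-Reasoning
  -- x ^ 3 is spelled out as x * (x * (x * 1)): the ring solver does not accept _^_.
  reassoc₁ : ∀ g k F →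
    g * (k * (k * (k * 1))) * (F * (F * (F * 1))) ≡ g * ((F * k) * ((F * k) * ((F * k) * 1)))
  reassoc₁ = solve-∀
  reassoc₂ : ∀ g c n →
    g * ((c * n) * ((c * n) * ((c * n) * 1))) ≡ n * (c * (c * (c * 1)) * (n * (n * 1)) * g)
  reassoc₂ = solve-∀

[2+i]³≤8*[1+i]³ : ∀ i → suc (suc i) ^ 3 ≤ 8 * suc i ^ 3
[2+i]³≤8*[1+i]³ i = begin
  suc (suc i) ^ 3     ≤⟨ ^-monoˡ-≤ 3 (s≤s (+-monoʳ-≤ 1 (m≤n+m i i))) ⟩
  (2 + (i + i)) ^ 3   ≡⟨ expand i ⟩
  8 * suc i ^ 3       ∎
  where
  open ≤-Reasoning
  expand : ∀ i →
    (2 + (i + i)) * ((2 + (i + i)) * ((2 + (i + i)) * 1)) ≡ 8 * ((1 + i) * ((1 + i) * ((1 + i) * 1)))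
  expand = solve-∀

k*[g*[1+2k]²]≤9*[g*k³] : ∀ g k → 1 ≤ k → k * (g * (suc (k + k) * suc (k + k))) ≤ 9 * (g * k ^ 3)
k*[g*[1+2k]²]≤9*[g*k³] g k 1≤k = begin
  k * (g * (suc (k + k) * suc (k + k)))   ≤⟨ *-monoʳ-≤ k (*-monoʳ-≤ g (*-mono-≤ 2k+1≤3k 2k+1≤3k)) ⟩
  k * (g * ((3 * k) * (3 * k)))           ≡⟨ expand g k ⟩
  9 * (g * k ^ 3)                         ∎
  where
  open ≤-Reasoning
  2k+1≤3k : suc (k + k) ≤ 3 * k
  2k+1≤3k = ≤-trans (+-monoˡ-≤ (k + k) 1≤k) (≤-reflexive (triple k))
    where
    triple : ∀ k → k + (k + k) ≡ 3 * k
    triple = solve-∀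
  expand : ∀ g k → k * (g * ((3 * k) * (3 * k))) ≡ 9 * (g * (k * (k * (k * 1))))
  expand = solve-∀

-- Used with j + 1 the cube root of n / g rounded up (see cube-bracket).
F*k≤486n : ∀ {F q n g} j → 1 ≤ g → F ≤ 6 * suc q → q ≤ n →
  suc j * q ≤ suc j * (g * (suc (suc j + suc j) * suc (suc j + suc j))) + n →
  g * j ^ 3 < n → F * suc j ≤ 486 * n
F*k≤486n {F} {q} {n} zero _ F≤ q≤n _ gj³<n = begin
  F * 1           ≡⟨ *-identityʳ F ⟩
  F               ≤⟨ F≤ ⟩
  6 * suc q       ≤⟨ *-monoʳ-≤ 6 (+-mono-≤ (≤-trans (s≤s z≤n) gj³<n) q≤n) ⟩
  6 * (n + n)     ≡⟨ double n ⟩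
  12 * n          ≤⟨ *-monoˡ-≤ n (m≤m+n 12 474) ⟩
  486 * n         ∎
  where
  open ≤-Reasoning
  double : ∀ n → 6 * (n + n) ≡ 12 * n
  double = solve-∀
F*k≤486n {F} {q} {n} {g} (suc i) 1≤g F≤ q≤n kq≤ gj³<n = begin
  F * k                   ≤⟨ *-monoˡ-≤ k F≤ ⟩
  6 * suc q * k           ≡⟨ distrib q k ⟩
  6 * (k + k * q)         ≤⟨ *-monoʳ-≤ 6 (+-mono-≤ k≤8n kq≤73n) ⟩
  6 * (8 * n + 73 * n)    ≡⟨ collect n ⟩
  486 * n                 ∎
  where
  open ≤-Reasoning
  k = suc (suc i)
  distrib : ∀ q k → 6 * (1 + q) * k ≡ 6 * (k + k * q)
  distrib = solve-∀
  collect : ∀ n → 6 * (8 * n + 73 * n) ≡ 486 * n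
  collect = solve-∀
  collect′ : ∀ n → 9 * (8 * n) + n ≡ 73 * n
  collect′ = solve-∀
  gk³≤8n : g * k ^ 3 ≤ 8 * n
  gk³≤8n = begin
    g * k ^ 3             ≤⟨ *-monoʳ-≤ g ([2+i]³≤8*[1+i]³ i) ⟩
    g * (8 * suc i ^ 3)   ≡⟨ *-x∙yz≈y∙xz g 8 (suc i ^ 3) ⟩
    8 * (g * suc i ^ 3)   ≤⟨ *-monoʳ-≤ 8 (<⇒≤ gj³<n) ⟩
    8 * n                 ∎
  k≤8n : k ≤ 8 * n
  k≤8n = ≤-trans (m≤m*n k (k ^ 2)) (≤-trans (m≤n*m (k ^ 3) g {{>-nonZero 1≤g}}) gk³≤8n)
  kq≤73n : k * q ≤ 73 * n
  kq≤73n = begin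
    k * q                                          ≤⟨ kq≤ ⟩
    k * (g * (suc (k + k) * suc (k + k))) + n      ≤⟨ +-monoˡ-≤ n (k*[g*[1+2k]²]≤9*[g*k³] g k (s≤s z≤n)) ⟩
    9 * (g * k ^ 3) + n                            ≤⟨ +-monoˡ-≤ n (*-monoʳ-≤ 9 gk³≤8n) ⟩
    9 * (8 * n) + n                                ≡⟨ collect′ n ⟩
    73 * n                                         ∎

grammarSize-positive : ∀ {σ} (G : Grammar σ) {s : Str σ} →
  Generates G s → 1 ≤ length s → 1 ≤ grammarSize G
grammarSize-positive G gen 1≤s with start G | gen
... | X ∷ rhs | _ = ≤-trans (s≤s z≤n) (m≤n+m (length (X ∷ rhs)) (rulesSize (rules G)))
... | []      | refl with 1≤s
...   | ()

module _ {σ : ℕ} (G : Grammar σ) {s : Str σ} (gen : Generates G s) where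

  ⌊log₂⌋≤grammarSize : ⌊log₂ length s ⌋ ≤ grammarSize G
  ⌊log₂⌋≤grammarSize =
    ≤-trans (⌊log₂⌋-mono-≤ (length≤2^grammarSize G gen)) (≤-reflexive (⌊log₂[2^n]⌋≡n (grammarSize G)))

  distinctBlocks-cube-bound : ∀ {A : Set} {a D} {ps : List A} → 1 ≤ length s → a ≤ 2 →
    DistinctBlocks a D ps s → ∀ {F} → F ≤ 3 * length ps → F ^ 3 ≤ 486 ^ 3 * length s ^ 2 * grammarSize G
  distinctBlocks-cube-bound {a = a} {ps = ps} 1≤n a≤2 B {F} F≤ =
    bound (cube-bracket g n n 1≤n (n≤g*[1+n]^3 g n 1≤g))
    where
    n = length s
    g = grammarSize G
    1≤g = grammarSize-positive G gen 1≤n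
    q = length (DistinctBlocks.blocks B)
    F≤6[1+q] : F ≤ 6 * suc q
    F≤6[1+q] = begin
      F                   ≤⟨ F≤ ⟩
      3 * length ps       ≤⟨ *-monoʳ-≤ 3 (DistinctBlocks.phrases≤ B) ⟩
      3 * (1 + a * q)     ≤⟨ *-monoʳ-≤ 3 (+-monoʳ-≤ 1 (*-monoˡ-≤ q a≤2)) ⟩
      3 * (1 + 2 * q)     ≤⟨ m≤m+n _ 3 ⟩
      3 * (1 + 2 * q) + 3 ≡⟨ regroup q ⟩
      6 * suc q           ∎
      where
      open ≤-Reasoning
      regroup : ∀ q → 3 * (1 + 2 * q) + 3 ≡ 6 * (1 + q)
      regroup = solve-∀
    bound : ∃[ j ] g * j ^ 3 < n × n ≤ g * suc j ^ 3 → F ^ 3 ≤ 486 ^ 3 * n ^ 2 * g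
    bound (j , gj³<n , n≤gk³) = cube-bound 486 F n g (suc j) 1≤n n≤gk³
      (F*k≤486n j 1≤g F≤6[1+q] (length-blocks≤ B) (*-length-blocks≤ B G gen (suc j)) gj³<n)

  distinctBlocks-bound : ∀ {A : Set} {a D} {ps : List A} → 1 ≤ length s → a ≤ 2 →
    DistinctBlocks a D ps s → ∀ {F} → F ≤ 3 * length ps →
    F ^ 3 * ⌊log₂ length s ⌋ ^ 2 ≤ 486 ^ 3 * length s ^ 2 * grammarSize G ^ 3
  distinctBlocks-bound 1≤n a≤2 B F≤ =
    ≤-trans (*-mono-≤ (distinctBlocks-cube-bound 1≤n a≤2 B F≤) (^-monoˡ-≤ 2 ⌊log₂⌋≤grammarSize))
      (≤-reflexive (*-assoc (486 ^ 3 * length s ^ 2) (grammarSize G) _))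

sum-map-≤ : ∀ {A : Set} (f : A → ℕ) {b} → (∀ x → f x ≤ b) → ∀ xs → sum (map f xs) ≤ length xs * b
sum-map-≤ f f≤b []       = z≤n
sum-map-≤ f f≤b (x ∷ xs) = +-mono-≤ (f≤b x) (sum-map-≤ f f≤b xs)

startRule+rules≤3*phrases : ∀ {A : Set} (ruleSize : A → ℕ) → (∀ p → ruleSize p ≤ 2) →
  ∀ ps → length ps + sum (map ruleSize ps) ≤ 3 * length ps
startRule+rules≤3*phrases ruleSize ≤2 ps =
  ≤-trans (+-monoʳ-≤ (length ps) (sum-map-≤ ruleSize ≤2 ps)) (≤-reflexive (regroup (length ps)))
  where
  regroup : ∀ z → z + z * 2 ≡ 3 * z
  regroup = solve-∀

lzdRuleSize≤2 : ∀ {σ} (p : Str σ × Str σ) → lzdRuleSize p ≤ 2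
lzdRuleSize≤2 (_ , [])    = s≤s z≤n
lzdRuleSize≤2 (_ , _ ∷ _) = ≤-refl

lzmwRuleSize≤2 : ∀ {σ} (p : Str σ) → lzmwRuleSize p ≤ 2
lzmwRuleSize≤2 []          = z≤n
lzmwRuleSize≤2 (_ ∷ [])    = s≤s z≤n
lzmwRuleSize≤2 (_ ∷ _ ∷ _) = ≤-refl

theorem2 : (σ : ℕ) → ∃[ c ] ∃[ N ]
  ((w : List (Fin σ)) (d : Fin σ) → d ∉ w → N ≤ length (w ∷ʳ d) →
   (G : Grammar σ) → Generates G (w ∷ʳ d) →
     (lzdGrammarSize (w ∷ʳ d) ^ 3 * ⌊log₂ length (w ∷ʳ d) ⌋ ^ 2
        ≤ c * length (w ∷ʳ d) ^ 2 * grammarSize G ^ 3)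
   × (lzmwGrammarSize (w ∷ʳ d) ^ 3 * ⌊log₂ length (w ∷ʳ d) ⌋ ^ 2
        ≤ c * length (w ∷ʳ d) ^ 2 * grammarSize G ^ 3))
theorem2 σ = 486 ^ 3 , 0 , λ w d _ _ G gen →
  let 1≤n = ≤-trans (m≤n+m 1 (length w)) (≤-reflexive (sym (length-++ w)))
  in distinctBlocks-bound G gen 1≤n (s≤s z≤n) (lzd-distinctBlocks (w ∷ʳ d))
       (startRule+rules≤3*phrases lzdRuleSize lzdRuleSize≤2 (lzd (w ∷ʳ d)))
   , distinctBlocks-bound G gen 1≤n ≤-refl (lzmw-distinctBlocks (w ∷ʳ d))
       (startRule+rules≤3*phrases lzmwRuleSize lzmwRuleSize≤2 (lzmw (w ∷ʳ d)))
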